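{- Let $G$ be a finite group, $H$ a proper subgroup of $G$, $C$ an inverse-closed subset of $G\setminus\{1\}$, and $\Gamma=\mathrm{Cay}(G,H,C)$. Then: (i) $\omega(\Gamma)\geq\psi(H\cap C)$. Moreover, $\omega(\Gamma)\geq\psi(H\cap C)+1$ if there exist $c\in C\setminus H$ and a subgroup $K$ of $G$ with $K\subseteq (H\cap C)\cup\{1\}$, $|K|=\psi(H\cap C)$ and $K\subseteq cC$. (ii) If $C^3\subseteq C$, then $\omega(\Gamma)\leq\psi(H\cap C)+1$.
   Context: $C$ inverse-closed means $C^{ -1}\subseteq C$. The relative Cayley graph $\Gamma=\mathrm{Cay}(G,H,C)$ is the simple graph with vertex set $G$ in which two distinct vertices $x,y$ are adjacent if and only if at least one of $x,y$ lies in $H$ and $x^{ -1}y\in C$. $\omega(\Gamma)$ is the clique number. For a subset $X\subseteq G$, $\psi(X)=\max\{|K|: K\leq G,\ K\subseteq X\cup\{1\}\}$ is the maximum order of a subgroup of $G$ contained in $X\cup\{1\}$. $C^3=\{abc:a,b,c\in C\}$, $cC=\{cx:x\in C\}$. -}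

module Defs where

open import Level using (0ℓ)
open import Data.Nat using (ℕ)
open import Data.Fin using (Fin)
open import Data.Fin.Subset using (Subset; _∈_; _∉_; ∣_∣)
open import Data.Product using (Σ; ∃; _×_; _,_)
open import Data.Sum using (_⊎_)
open import Relation.Binary.PropositionalEquality using (_≡_; _≢_)
open import Algebra.Structures using (IsGroup)

-- A finite group: WLOG its carrier is Fin n (every finite group is
-- isomorphic to one of this form), with propositional equality.
record FiniteGroup : Set where
  field
    n       : ℕ
    _∙_     : Fin n → Fin n → Fin n
    ε       : Fin n
    _⁻¹     : Fin n → Fin n
    isGroup : IsGroup _≡_ _∙_ ε _⁻¹
  infixl 7 _∙_
  infix 8 _⁻¹

module _ (G : FiniteGroup) where
  open FiniteGroup G

  IsSubgroup : Subset n → Set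
  IsSubgroup K = (ε ∈ K)
               × (∀ x y → x ∈ K → y ∈ K → (x ∙ y) ∈ K)
               × (∀ x → x ∈ K → (x ⁻¹) ∈ K)

  IsProperSubgroup : Subset n → Set
  IsProperSubgroup H = IsSubgroup H × ∃ λ x → x ∉ H

  IsConnectionSet : Subset n → Set
  IsConnectionSet C = (ε ∉ C) × (∀ x → x ∈ C → (x ⁻¹) ∈ C)

  Adj : Subset n → Subset n → Fin n → Fin n → Set
  Adj H C x y = (x ≢ y) × ((x ∈ H) ⊎ (y ∈ H)) × ((x ⁻¹ ∙ y) ∈ C)

  IsClique : Subset n → Subset n → Subset n → Set
  IsClique H C Q = ∀ x y → x ∈ Q → y ∈ Q → x ≢ y → Adj H C x y

  IsCliqueNumber : Subset n → Subset n → ℕ → Set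
  IsCliqueNumber H C w =
    (Σ (Subset n) λ Q → IsClique H C Q × ∣ Q ∣ ≡ w)
    × (∀ Q → IsClique H C Q → ∣ Q ∣ Data.Nat.≤ w)

  _⊆∪1_ : Subset n → (Fin n → Set) → Set
  K ⊆∪1 X = ∀ x → x ∈ K → X x ⊎ x ≡ ε

  IsPsi : (Fin n → Set) → ℕ → Set
  IsPsi X p =
    (Σ (Subset n) λ K → IsSubgroup K × K ⊆∪1 X × ∣ K ∣ ≡ p)
    × (∀ K → IsSubgroup K → K ⊆∪1 X → ∣ K ∣ Data.Nat.≤ p)

  InBoth : Subset n → Subset n → Fin n → Set
  InBoth H C x = (x ∈ H) × (x ∈ C)

  CubeClosed : Subset n → Set
  CubeClosed C = ∀ a b c → a ∈ C → b ∈ C → c ∈ C → (a ∙ b ∙ c) ∈ C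

  _⊆_·_ : Subset n → Fin n → Subset n → Set
  K ⊆ c · C = ∀ k → k ∈ K → Σ (Fin n) λ x → x ∈ C × k ≡ c ∙ x

-- Every subgroup K inside (H ∩ C) ∪ {1} is a clique: its vertices lie in H and
-- x⁻¹y ∈ K ∖ {1} ⊆ C. If moreover K ⊆ cC with c ∉ H, then c is adjacent to every
-- k = cz ∈ K, since c⁻¹k = z and k⁻¹c = z⁻¹ both lie in C; so K ∪ {c} is a larger
-- clique. Conversely, for three distinct vertices a, b, x of a clique the labels
-- a⁻¹b, b⁻¹x, x⁻¹a lie in C and multiply to 1 ∉ C, so C³ ⊆ C forces ω ≤ 2 ≤ ψ + 1,
-- the trivial subgroup giving ψ ≥ 1.
module Submission where

open import Defs
open import Data.Nat using (ℕ; _≤_; _<_; _+_; suc; s≤s; z≤n)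
open import Data.Nat.Properties using (≤-trans; ≤-reflexive; n≤1+n; +-suc; +-monoʳ-≤)
open import Data.Fin using (Fin)
open import Data.Fin.Subset
  using (Subset; _∈_; _∉_; ∣_∣; ⁅_⁆; _∪_; inside; outside; _⊆_)
  renaming (⊥ to ∅)
open import Data.Fin.Subset.Properties
  using ( x∈⁅x⁆; x∈⁅y⁆⇒x≡y; ∣⁅x⁆∣≡1; ∣⊥∣≡0; p⊆q⇒∣p∣≤∣q∣; p⊂q⇒∣p∣<∣q∣
        ; p⊆p∪q; x∈p∪q⁻; x∈p∪q⁺; _∈?_)
open import Data.Fin.Properties using (any?; _≟_)
open import Data.Vec using ([]; _∷_)
open import Function using (_∘_; _$_)
open import Data.Product using (Σ; _×_; _,_; proj₂)
open import Data.Sum using (inj₁; inj₂)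
open import Data.Empty using (⊥; ⊥-elim)
open import Relation.Nullary using (yes; no)
open import Relation.Nullary.Decidable using (_×-dec_; ¬?)
open import Relation.Binary.PropositionalEquality
open import Algebra.Structures using (IsGroup)
open import Algebra.Bundles using (Group)
import Algebra.Properties.Group as GroupProperties

∣p∪q∣≤∣p∣+∣q∣ : ∀ {m} (p q : Subset m) → ∣ p ∪ q ∣ ≤ ∣ p ∣ + ∣ q ∣
∣p∪q∣≤∣p∣+∣q∣ []            []            = z≤n
∣p∪q∣≤∣p∣+∣q∣ (outside ∷ p) (outside ∷ q) = ∣p∪q∣≤∣p∣+∣q∣ p q
∣p∪q∣≤∣p∣+∣q∣ (outside ∷ p) (inside ∷ q)  =
  ≤-trans (s≤s (∣p∪q∣≤∣p∣+∣q∣ p q)) (≤-reflexive (sym (+-suc ∣ p ∣ ∣ q ∣)))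
∣p∪q∣≤∣p∣+∣q∣ (inside ∷ p)  (outside ∷ q) = s≤s (∣p∪q∣≤∣p∣+∣q∣ p q)
∣p∪q∣≤∣p∣+∣q∣ (inside ∷ p)  (inside ∷ q)  =
  s≤s (≤-trans (∣p∪q∣≤∣p∣+∣q∣ p q) (+-monoʳ-≤ ∣ p ∣ (n≤1+n ∣ q ∣)))

x∉p⇒∣p∣<∣p∪⁅x⁆∣ : ∀ {m} {x : Fin m} {p : Subset m} → x ∉ p → ∣ p ∣ < ∣ p ∪ ⁅ x ⁆ ∣
x∉p⇒∣p∣<∣p∪⁅x⁆∣ {x = x} {p} x∉p =
  p⊂q⇒∣p∣<∣q∣ (p⊆p∪q ⁅ x ⁆ , x , x∈p∪q⁺ (inj₂ (x∈⁅x⁆ x)) , x∉p)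

NoThreeDistinct : ∀ {m} → Subset m → Set
NoThreeDistinct p = ∀ {x y z} → x ∈ p → y ∈ p → z ∈ p
                  → x ≢ y → z ≢ x → z ≢ y → ⊥

noThreeDistinct⇒∣p∣≤2 : ∀ {m} (p : Subset m) → NoThreeDistinct p → ∣ p ∣ ≤ 2
noThreeDistinct⇒∣p∣≤2 {m} p no-three with any? (_∈? p)
... | no p-empty =
  ≤-trans (p⊆q⇒∣p∣≤∣q∣ {q = ∅} (λ {x} x∈p → ⊥-elim (p-empty (x , x∈p))))
          (≤-trans (≤-reflexive (∣⊥∣≡0 m)) z≤n)
... | yes (a , a∈p) with any? (λ b → (b ∈? p) ×-dec ¬? (b ≟ a))
...   | no only-a = ≤-trans (p⊆q⇒∣p∣≤∣q∣ p⊆⁅a⁆) (≤-trans (≤-reflexive (∣⁅x⁆∣≡1 a)) (s≤s z≤n))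
  where
  p⊆⁅a⁆ : p ⊆ ⁅ a ⁆
  p⊆⁅a⁆ {x} x∈p with x ≟ a
  ... | yes refl = x∈⁅x⁆ a
  ... | no x≢a   = ⊥-elim (only-a (x , x∈p , x≢a))
...   | yes (b , b∈p , b≢a) = ≤-trans (p⊆q⇒∣p∣≤∣q∣ p⊆⁅a,b⁆) ∣⁅a,b⁆∣≤2
  where
  p⊆⁅a,b⁆ : p ⊆ ⁅ a ⁆ ∪ ⁅ b ⁆
  p⊆⁅a,b⁆ {x} x∈p with x ≟ a | x ≟ b
  ... | yes refl | _        = x∈p∪q⁺ (inj₁ (x∈⁅x⁆ a))
  ... | no _     | yes refl = x∈p∪q⁺ (inj₂ (x∈⁅x⁆ b))
  ... | no x≢a   | no x≢b   = ⊥-elim (no-three a∈p b∈p x∈p (λ a≡b → b≢a (sym a≡b)) x≢a x≢b)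
  ∣⁅a,b⁆∣≤2 : ∣ ⁅ a ⁆ ∪ ⁅ b ⁆ ∣ ≤ 2
  ∣⁅a,b⁆∣≤2 = ≤-trans (∣p∪q∣≤∣p∣+∣q∣ ⁅ a ⁆ ⁅ b ⁆)
                      (≤-reflexive (cong₂ _+_ (∣⁅x⁆∣≡1 a) (∣⁅x⁆∣≡1 b)))

module _ (G : FiniteGroup) where
  open FiniteGroup G
  open IsGroup isGroup using (assoc; identityˡ; identityʳ; inverseˡ)

  private
    group : Group _ _
    group = record { Carrier = Fin n ; _≈_ = _≡_ ; _∙_ = _∙_ ; ε = ε ; _⁻¹ = _⁻¹ ; isGroup = isGroup }

  open GroupProperties group using (\\-leftDividesˡ; \\-leftDividesʳ; ⁻¹-anti-homo-\\; ε⁻¹≈ε)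

  ⁻¹∙-trans : ∀ x y z → (x ⁻¹ ∙ y) ∙ (y ⁻¹ ∙ z) ≡ x ⁻¹ ∙ z
  ⁻¹∙-trans x y z = begin
    (x ⁻¹ ∙ y) ∙ (y ⁻¹ ∙ z) ≡⟨ assoc (x ⁻¹) y (y ⁻¹ ∙ z) ⟩
    x ⁻¹ ∙ (y ∙ (y ⁻¹ ∙ z)) ≡⟨ cong (x ⁻¹ ∙_) (\\-leftDividesˡ y z) ⟩
    x ⁻¹ ∙ z                ∎
    where open ≡-Reasoning

  ⁻¹∙≡ε⇒≡ : ∀ x y → x ⁻¹ ∙ y ≡ ε → x ≡ y
  ⁻¹∙≡ε⇒≡ x y x⁻¹y≡ε = begin
    x              ≡⟨ identityʳ x ⟨
    x ∙ ε          ≡⟨ cong (x ∙_) x⁻¹y≡ε ⟨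
    x ∙ (x ⁻¹ ∙ y) ≡⟨ \\-leftDividesˡ x y ⟩
    y              ∎
    where open ≡-Reasoning

  ⁅ε⁆-isSubgroup : IsSubgroup G ⁅ ε ⁆
  ⁅ε⁆-isSubgroup = x∈⁅x⁆ ε , ∙-closed , ⁻¹-closed
    where
    ∙-closed : ∀ x y → x ∈ ⁅ ε ⁆ → y ∈ ⁅ ε ⁆ → x ∙ y ∈ ⁅ ε ⁆
    ∙-closed x y x∈ y∈ rewrite x∈⁅y⁆⇒x≡y ε x∈ | x∈⁅y⁆⇒x≡y ε y∈ | identityˡ ε = x∈⁅x⁆ ε
    ⁻¹-closed : ∀ x → x ∈ ⁅ ε ⁆ → x ⁻¹ ∈ ⁅ ε ⁆
    ⁻¹-closed x x∈ rewrite x∈⁅y⁆⇒x≡y ε x∈ | ε⁻¹≈ε = x∈⁅x⁆ ε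

  IsPsi⇒1≤ψ : ∀ {X ψ} → IsPsi G X ψ → 1 ≤ ψ
  IsPsi⇒1≤ψ (_ , maximal) = subst (_≤ _) (∣⁅x⁆∣≡1 ε)
    (maximal ⁅ ε ⁆ ⁅ε⁆-isSubgroup (λ x x∈ → inj₂ (x∈⁅y⁆⇒x≡y ε x∈)))

  ⊆∪1-InBoth⇒⊆ : ∀ {H C K} → ε ∈ H → _⊆∪1_ G K (InBoth G H C) → K ⊆ H
  ⊆∪1-InBoth⇒⊆ ε∈H K⊆ {x} x∈K with K⊆ x x∈K
  ... | inj₁ (x∈H , _) = x∈H
  ... | inj₂ refl      = ε∈H

  subgroup⇒clique : ∀ {H C K} → ε ∈ H → IsSubgroup G K → _⊆∪1_ G K (InBoth G H C)
                  → IsClique G H C K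
  subgroup⇒clique {C = C} ε∈H (_ , ∙-closed , ⁻¹-closed) K⊆ x y x∈K y∈K x≢y =
    x≢y , inj₁ (⊆∪1-InBoth⇒⊆ ε∈H K⊆ x∈K) , x⁻¹y∈C
    where
    x⁻¹y∈C : x ⁻¹ ∙ y ∈ C
    x⁻¹y∈C with K⊆ (x ⁻¹ ∙ y) (∙-closed _ _ (⁻¹-closed x x∈K) y∈K)
    ... | inj₁ (_ , x⁻¹y∈C) = x⁻¹y∈C
    ... | inj₂ x⁻¹y≡ε       = ⊥-elim (x≢y (⁻¹∙≡ε⇒≡ x y x⁻¹y≡ε))

  ⊆·⇒⁻¹∙∈ : ∀ {K c C} → _⊆_·_ G K c C → ∀ {k} → k ∈ K → c ⁻¹ ∙ k ∈ C
  ⊆·⇒⁻¹∙∈ {C = C} K⊆cC k∈K with K⊆cC _ k∈K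
  ... | z , z∈C , refl = subst (_∈ C) (sym (\\-leftDividesʳ _ z)) z∈C

  clique-∪⁅⁆ : ∀ {H C Q c} → (∀ x → x ∈ C → x ⁻¹ ∈ C) → IsClique G H C Q → Q ⊆ H
             → (∀ {x} → x ∈ Q → c ⁻¹ ∙ x ∈ C) → IsClique G H C (Q ∪ ⁅ c ⁆)
  clique-∪⁅⁆ {C = C} {Q} {c} C⁻¹⊆C clique Q⊆H c⁻¹Q⊆C x y x∈ y∈ x≢y
    with x∈p∪q⁻ Q ⁅ c ⁆ x∈ | x∈p∪q⁻ Q ⁅ c ⁆ y∈
  ... | inj₁ x∈Q   | inj₁ y∈Q   = clique x y x∈Q y∈Q x≢y
  ... | inj₁ x∈Q   | inj₂ y∈⁅c⁆ rewrite x∈⁅y⁆⇒x≡y c y∈⁅c⁆ =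
    x≢y , inj₁ (Q⊆H x∈Q) , subst (_∈ C) (⁻¹-anti-homo-\\ c x) (C⁻¹⊆C _ (c⁻¹Q⊆C x∈Q))
  ... | inj₂ x∈⁅c⁆ | inj₁ y∈Q   rewrite x∈⁅y⁆⇒x≡y c x∈⁅c⁆ =
    x≢y , inj₂ (Q⊆H y∈Q) , c⁻¹Q⊆C y∈Q
  ... | inj₂ x∈⁅c⁆ | inj₂ y∈⁅c⁆ =
    ⊥-elim (x≢y (trans (x∈⁅y⁆⇒x≡y c x∈⁅c⁆) (sym (x∈⁅y⁆⇒x≡y c y∈⁅c⁆))))

  cubeClosed⇒clique-noThreeDistinct : ∀ {H C Q} → ε ∉ C → CubeClosed G C
                                    → IsClique G H C Q → NoThreeDistinct Q
  cubeClosed⇒clique-noThreeDistinct {C = C} ε∉C cube clique {x} {y} {z} x∈ y∈ z∈ x≢y z≢x z≢y =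
    ε∉C (subst (_∈ C) round-trip
      (cube _ _ _ (label x∈ y∈ x≢y) (label y∈ z∈ (z≢y ∘ sym)) (label z∈ x∈ z≢x)))
    where
    label : ∀ {u v} → u ∈ _ → v ∈ _ → u ≢ v → u ⁻¹ ∙ v ∈ C
    label u∈ v∈ u≢v = proj₂ (proj₂ (clique _ _ u∈ v∈ u≢v))
    round-trip : (x ⁻¹ ∙ y) ∙ (y ⁻¹ ∙ z) ∙ (z ⁻¹ ∙ x) ≡ ε
    round-trip = begin
      (x ⁻¹ ∙ y) ∙ (y ⁻¹ ∙ z) ∙ (z ⁻¹ ∙ x) ≡⟨ cong (_∙ (z ⁻¹ ∙ x)) (⁻¹∙-trans x y z) ⟩
      (x ⁻¹ ∙ z) ∙ (z ⁻¹ ∙ x)              ≡⟨ ⁻¹∙-trans x z x ⟩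
      x ⁻¹ ∙ x                             ≡⟨ inverseˡ x ⟩
      ε                                    ∎
      where open ≡-Reasoning

mainTheorem5 : (G : FiniteGroup) (H C : Subset (FiniteGroup.n G))
    → IsProperSubgroup G H → IsConnectionSet G C
    → (w p : ℕ) → IsCliqueNumber G H C w → IsPsi G (InBoth G H C) p
    → (p ≤ w)
      × ((Σ (Fin (FiniteGroup.n G)) λ c → (c ∈ C) × (c ∉ H)
           × Σ (Subset (FiniteGroup.n G)) λ K → IsSubgroup G K
             × _⊆∪1_ G K (InBoth G H C) × (∣ K ∣ ≡ p) × _⊆_·_ G K c C)
         → suc p ≤ w)
      × (CubeClosed G C → w ≤ suc p)
mainTheorem5 G H C ((ε∈H , _) , _) (ε∉C , C⁻¹⊆C) w p
             ((Q , Q-clique , refl) , ω-maximal) ψ@((K , K≤G , K⊆ , refl) , _) =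
    ω-maximal K (subgroup⇒clique G ε∈H K≤G K⊆)
  , (λ (c , _ , c∉H , K′ , K′≤G , K′⊆ , ∣K′∣≡ψ , K′⊆cC) →
       subst (λ k → suc k ≤ ∣ Q ∣) ∣K′∣≡ψ (extension-bound c∉H K′≤G K′⊆ K′⊆cC))
  , cube-bound
  where
  extension-bound : ∀ {c K′} → c ∉ H → IsSubgroup G K′ → _⊆∪1_ G K′ (InBoth G H C)
                  → _⊆_·_ G K′ c C → suc ∣ K′ ∣ ≤ ∣ Q ∣
  extension-bound {K′ = K′} c∉H K′≤G K′⊆ K′⊆cC = ≤-trans
    (x∉p⇒∣p∣<∣p∪⁅x⁆∣ (c∉H ∘ K′⊆H))
    (ω-maximal _ (clique-∪⁅⁆ G C⁻¹⊆C (subgroup⇒clique G ε∈H K′≤G K′⊆) K′⊆H (⊆·⇒⁻¹∙∈ G K′⊆cC)))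
    where
    K′⊆H : K′ ⊆ H
    K′⊆H = ⊆∪1-InBoth⇒⊆ G ε∈H K′⊆

  cube-bound : CubeClosed G C → ∣ Q ∣ ≤ suc ∣ K ∣
  cube-bound cube = ≤-trans
    (noThreeDistinct⇒∣p∣≤2 Q (cubeClosed⇒clique-noThreeDistinct G ε∉C cube Q-clique))
    (s≤s (IsPsi⇒1≤ψ G ψ))
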